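{- Let $\vec C$ be an oriented cycle which has a long block. If $G$ is a graph with $m(G)<m_2(\vec C)$, then $G\not\to\vec C$, i.e., $G$ has an orientation containing no copy of $\vec C$.
   Context: An oriented cycle is an orientation of a cycle $C_\ell$. In an oriented graph, a directed path is $v_1\to v_2\to\dots\to v_k$; a block is a maximal directed path; a block is long if it has at least $3$ edges. $m(G)=\max\{e(J)/v(J):J\subseteq G,\ v(J)\ge1\}$ and $m_2(G)=\max\{(e(J)-1)/(v(J)-2):J\subseteq G,\ v(J)\ge3\}$, densities of oriented graphs being those of their underlying graphs. -}

module Defs where

open import Data.Bool using (Bool; true; false; _∧_; _∨_; not; if_then_else_)
open import Data.Nat using (ℕ; zero; suc; _+_; _*_; _∸_; _≤_; _<_; _%_; _≡ᵇ_)
open import Data.Fin using (Fin; toℕ; inject₁; fromℕ; _<?_)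
import Data.Fin as F
open import Data.List using (List; map; allFin)
open import Data.Nat.ListAction using (sum)
open import Data.Product using (Σ; ∃; _×_; _,_)
open import Data.Empty using (⊥)
open import Data.Sum using (_⊎_)
open import Relation.Nullary using (¬_; does)
open import Relation.Binary.PropositionalEquality using (_≡_)
open import Function.Definitions using (Injective)

record Graph : Set where
  field
    n      : ℕ
    adj    : Fin n → Fin n → Bool
    sym    : ∀ i j → adj i j ≡ adj j i
    irrefl : ∀ i → adj i i ≡ false

record Subgraph {n : ℕ} (adj : Fin n → Fin n → Bool) : Set where
  field
    S    : Fin n → Bool
    E    : Fin n → Fin n → Bool
    E⊆   : ∀ i j → E i j ≡ true → adj i j ≡ true
    Esym : ∀ i j → E i j ≡ E j i
    Eend : ∀ i j → E i j ≡ true → S i ≡ true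

b2n : Bool → ℕ
b2n true  = 1
b2n false = 0

count : {n : ℕ} → (Fin n → Bool) → ℕ
count {n} P = sum (map (λ i → b2n (P i)) (allFin n))

vJ : {n : ℕ} {adj : Fin n → Fin n → Bool} → Subgraph adj → ℕ
vJ J = count (Subgraph.S J)

eJ : {n : ℕ} {adj : Fin n → Fin n → Bool} → Subgraph adj → ℕ
eJ {n} J = sum (map (λ i → count (λ j → does (i <? j) ∧ Subgraph.E J i j)) (allFin n))

-- m(G) < m₂(H), where m(G) = max{e(J)/v(J) : J ⊆ G, v(J) ≥ 1} and
-- m₂(H) = max{(e(J)-1)/(v(J)-2) : J ⊆ H, v(J) ≥ 3}. Since both maxima are
-- over finite sets, m(G) < m₂(H) unfolds to: some J ⊆ H with v(J) ≥ 3
-- beats every J' ⊆ G with v(J') ≥ 1 (fractions compared by cross-multiplying;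
-- the case e(J) = 0, i.e. a negative value, is handled correctly by ∸).
mLessm₂ : {n : ℕ} (adjG : Fin n → Fin n → Bool)
          {k : ℕ} (adjH : Fin k → Fin k → Bool) → Set
mLessm₂ adjG adjH =
  Σ (Subgraph adjH) λ J → (3 ≤ vJ J) ×
    ((J' : Subgraph adjG) → 1 ≤ vJ J' →
       eJ J' * (vJ J ∸ 2) < (eJ J ∸ 1) * vJ J')

-- Oriented cycles: vertices Fin ℓ (ℓ ≥ 3), edges {i, i+1 mod ℓ};
-- dir i = true means the edge {i, i+1} is oriented i → i+1, else i+1 → i.

record OrientedCycle : Set where
  field
    ℓ   : ℕ
    3≤ℓ : 3 ≤ ℓ
    dir : Fin ℓ → Bool

cnext : {ℓ : ℕ} → Fin ℓ → ℕ
cnext {suc m} u = suc (toℕ u) % suc m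

arc : (C : OrientedCycle) → Fin (OrientedCycle.ℓ C) → Fin (OrientedCycle.ℓ C) → Bool
arc C u v = ((toℕ v ≡ᵇ cnext u) ∧ OrientedCycle.dir C u)
          ∨ ((toℕ u ≡ᵇ cnext v) ∧ not (OrientedCycle.dir C v))

underlying : (C : OrientedCycle) → Fin (OrientedCycle.ℓ C) → Fin (OrientedCycle.ℓ C) → Bool
underlying C u v = arc C u v ∨ arc C v u

record DirPath (C : OrientedCycle) (k : ℕ) : Set where
  field
    p    : Fin (suc k) → Fin (OrientedCycle.ℓ C)
    inj  : Injective _≡_ _≡_ p
    arcs : ∀ (i : Fin k) → arc C (p (inject₁ i)) (p (F.suc i)) ≡ true

-- a block: a maximal directed path (cannot be extended at either end)
IsBlock : {C : OrientedCycle} {k : ℕ} → DirPath C k → Set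
IsBlock {C} {k} P =
  (¬ Σ (Fin (OrientedCycle.ℓ C)) λ w → ((i : Fin (suc k)) → ¬ (DirPath.p P i ≡ w))
        × (arc C w (DirPath.p P F.zero) ≡ true))
  × (¬ Σ (Fin (OrientedCycle.ℓ C)) λ w → ((i : Fin (suc k)) → ¬ (DirPath.p P i ≡ w))
        × (arc C (DirPath.p P (fromℕ k)) w ≡ true))

HasLongBlock : OrientedCycle → Set
HasLongBlock C = Σ ℕ λ k → Σ (DirPath C k) λ P → IsBlock P × (3 ≤ k)

record Orientation (G : Graph) : Set where
  field
    o     : Fin (Graph.n G) → Fin (Graph.n G) → Bool
    o⊆    : ∀ i j → o i j ≡ true → Graph.adj G i j ≡ true
    total : ∀ i j → Graph.adj G i j ≡ true → (o i j ≡ true) ⊎ (o j i ≡ true)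
    anti  : ∀ i j → o i j ≡ true → o j i ≡ false

ContainsCopy : {G : Graph} → Orientation G → OrientedCycle → Set
ContainsCopy {G} O C =
  Σ (Fin (OrientedCycle.ℓ C) → Fin (Graph.n G)) λ φ → Injective _≡_ _≡_ φ
    × (∀ u v → arc C u v ≡ true → Orientation.o O (φ u) (φ v) ≡ true)

-- A long block of C forces ℓ ≥ 4, and then every subgraph J of the cycle C_ℓ with v(J) ≥ 3 has
-- 2(e(J) − 1) ≤ 3(v(J) − 2): J has at most v(J) edges, and at most two when v(J) = 3 because
-- three vertices of a cycle of length ≥ 4 do not span a triangle.  So m(G) < m₂(C) ≤ 3/2, every
-- nonempty vertex set of G contains a vertex with at most two neighbours in it, and G is
-- 2-degenerate, hence properly 3-colourable.  Orient each edge towards its larger colour: then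
-- every directed path has at most two arcs, whereas the long block of C has three.

module Submission where

open import Defs
open import Data.Bool using (Bool; true; false; _∧_; _∨_; if_then_else_)
import Data.Bool.Properties as Bool
open import Data.Bool.Properties
  using (∧-comm; ∧-zeroʳ; ∧-conicalˡ; ∧-conicalʳ; ¬-not; not-¬; T-≡)
open import Data.Empty using (⊥-elim)
open import Data.Fin using (Fin; zero; suc; toℕ; fromℕ; fromℕ<; inject₁; _<?_)
open import Data.Fin.Properties
  using ( _≟_; <-cmp; <-asym; any?; all?; ¬∀⟶∃¬; suc-injective; 0≢1+n; injective⇒≤
        ; toℕ-injective; toℕ-fromℕ<; toℕ<n)
open import Data.List using (map; tabulate; allFin)
open import Data.List.Properties using (map-tabulate)
import Data.Nat.ListAction as List
open import Data.Nat
  using (ℕ; zero; suc; _+_; _*_; _∸_; _≤_; _<_; z≤n; s≤s; NonZero; _≡ᵇ_; _≤?_)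
open import Data.Nat.DivMod
  using (_%_; m%n<n; %-distribˡ-+; m%n%n≡m%n; m<n⇒m%n≡m; [m+n]%n≡m%n; n%n≡0)
open import Data.Nat.GeneralisedArithmetic using (iterate)
open import Data.Nat.Properties
  using ( ≤-refl; ≤-reflexive; ≤-trans; ≤-<-trans; ≤-pred; <⇒≤; <⇒≢; <⇒≱; ≰⇒>; m≤n⇒m<n∨m≡n
        ; 1+n≢n; 1+n≢0; ≡ᵇ⇒≡; +-comm; +-assoc; +-suc; +-identityʳ; m≤m+n; m∸n+n≡m
        ; +-mono-≤; +-mono-≤-<; +-mono-<-≤; *-assoc; *-monoʳ-≤; *-monoˡ-≤; *-monoʳ-<
        ; *-cancelˡ-≤; *-cancelˡ-<; ∸-monoˡ-≤; +-*-semiring; module ≤-Reasoning)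
open import Data.Nat.Tactic.RingSolver using (solve-∀)
open import Algebra.Properties.Semiring.Sum +-*-semiring
  using (sum-syntax; sum-cong-≗; ∑-comm; ∑-distrib-+; *-distribˡ-sum)
open import Data.Product using (Σ; ∃; _×_; _,_; proj₁; proj₂)
open import Data.Sum using (_⊎_; inj₁; inj₂; swap; reduce)
open import Function.Base using (_∘_)
open import Function.Bundles using (Equivalence)
open import Function.Definitions using (Injective)
open import Relation.Binary.Definitions using (tri<; tri≈; tri>)
open import Relation.Binary.PropositionalEquality
open import Relation.Nullary using (¬_; Dec; does; yes; no)
open import Relation.Nullary.Decidable using (dec-true; dec-false; _×-dec_)

-- Counting

sum-map-allFin : ∀ {n} (f : Fin n → ℕ) → List.sum (map f (allFin n)) ≡ ∑[ i < n ] f i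
sum-map-allFin {n} f = trans (cong List.sum (map-tabulate (λ i → i) f)) (sum-tabulate f)
  where
  sum-tabulate : ∀ {n} (g : Fin n → ℕ) → List.sum (tabulate g) ≡ ∑[ i < n ] g i
  sum-tabulate {zero} g = refl
  sum-tabulate {suc n} g = cong (g zero +_) (sum-tabulate (g ∘ suc))

count≡∑ : ∀ {n} (P : Fin n → Bool) → count P ≡ ∑[ i < n ] b2n (P i)
count≡∑ P = sum-map-allFin (b2n ∘ P)

count-suc : ∀ {n} (P : Fin (suc n) → Bool) → count P ≡ b2n (P zero) + count (P ∘ suc)
count-suc P = trans (count≡∑ P) (cong (b2n (P zero) +_) (sym (count≡∑ (P ∘ suc))))

count-none : ∀ {n} (P : Fin n → Bool) → (∀ i → P i ≢ true) → count P ≡ 0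
count-none {zero} P none = refl
count-none {suc n} P none = trans (count-suc P)
  (cong₂ _+_ (cong b2n (¬-not (none zero))) (count-none (P ∘ suc) (none ∘ suc)))

_without_ : ∀ {n} → (Fin n → Bool) → Fin n → Fin n → Bool
(P without a) u = if does (u ≟ a) then false else P u

without-true : ∀ {n} (P : Fin n → Bool) {a u} → P u ≡ true → u ≢ a → (P without a) u ≡ true
without-true P {a} {u} Pu u≢a with u ≟ a
... | yes u≡a = ⊥-elim (u≢a u≡a)
... | no _ = Pu

count-remove : ∀ {n} (P : Fin n → Bool) {a} → P a ≡ true → count P ≡ suc (count (P without a))
count-remove {suc n} P {zero} Pa = begin
  count P                         ≡⟨ count-suc P ⟩
  b2n (P zero) + count (P ∘ suc)  ≡⟨ cong (λ b → b2n b + count (P ∘ suc)) Pa ⟩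
  suc (count (P ∘ suc))           ≡⟨ cong suc (sym (count-suc (P without zero))) ⟩
  suc (count (P without zero))    ∎
  where open ≡-Reasoning
count-remove {suc n} P {suc a} Pa = begin
  count P                                           ≡⟨ count-suc P ⟩
  b2n (P zero) + count (P ∘ suc)
    ≡⟨ cong (b2n (P zero) +_) (count-remove (P ∘ suc) Pa) ⟩
  b2n (P zero) + suc (count ((P ∘ suc) without a))  ≡⟨ +-suc _ _ ⟩
  suc (b2n (P zero) + count ((P ∘ suc) without a))
    ≡⟨ cong suc (sym (count-suc (P without suc a))) ⟩
  suc (count (P without suc a))                     ∎
  where open ≡-Reasoning

count-pos : ∀ {n} (P : Fin n → Bool) {a} → P a ≡ true → 1 ≤ count P
count-pos P Pa rewrite count-remove P Pa = s≤s z≤n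

injective⇒≤count : ∀ {m n} (P : Fin n → Bool) (f : Fin m → Fin n) → Injective _≡_ _≡_ f →
                   (∀ i → P (f i) ≡ true) → m ≤ count P
injective⇒≤count {zero} P f f-inj Pf = z≤n
injective⇒≤count {suc m} P f f-inj Pf =
  ≤-trans (s≤s (injective⇒≤count (P without f zero) (f ∘ suc) (suc-injective ∘ f-inj) Pf′))
          (≤-reflexive (sym (count-remove P (Pf zero))))
  where
  Pf′ : ∀ i → (P without f zero) (f (suc i)) ≡ true
  Pf′ i = without-true P (Pf (suc i)) (λ e → 0≢1+n (f-inj (sym e)))

AtMostOne : ∀ {n} → (Fin n → Set) → Set
AtMostOne Q = ∀ {u v} → Q u → Q v → u ≡ v

count≤1 : ∀ {n} (P : Fin n → Bool) (Q : Fin n → Set) → AtMostOne Q →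
          (∀ u → P u ≡ true → Q u) → count P ≤ 1
count≤1 {zero} P Q amo cover = z≤n
count≤1 {suc n} P Q amo cover rewrite count-suc P with P zero in P₀
... | true = ≤-reflexive (cong suc (count-none (P ∘ suc) only-zero))
  where
  only-zero : ∀ u → P (suc u) ≢ true
  only-zero u Pu = 0≢1+n (amo (cover zero P₀) (cover (suc u) Pu))
... | false = count≤1 (P ∘ suc) (Q ∘ suc) (λ p q → suc-injective (amo p q)) (cover ∘ suc)

count-tail≤1 : ∀ {n} (P : Fin (suc n) → Bool) {Q R : Fin (suc n) → Set} →
               AtMostOne Q → AtMostOne R → (∀ u → P u ≡ true → Q u ⊎ R u) → Q zero →
               count (P ∘ suc) ≤ 1
count-tail≤1 P {R = R} amoQ amoR cover Q₀ =
  count≤1 (P ∘ suc) (R ∘ suc) (λ p q → suc-injective (amoR p q)) only-R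
  where
  only-R : ∀ u → P (suc u) ≡ true → R (suc u)
  only-R u Pu with cover (suc u) Pu
  ... | inj₁ Qu = ⊥-elim (0≢1+n (amoQ Q₀ Qu))
  ... | inj₂ Ru = Ru

count≤2 : ∀ {n} (P : Fin n → Bool) (Q R : Fin n → Set) → AtMostOne Q → AtMostOne R →
          (∀ u → P u ≡ true → Q u ⊎ R u) → count P ≤ 2
count≤2 {zero} P Q R amoQ amoR cover = z≤n
count≤2 {suc n} P Q R amoQ amoR cover rewrite count-suc P with P zero in P₀
... | true with cover zero P₀
...   | inj₁ Q₀ = s≤s (count-tail≤1 P amoQ amoR cover Q₀)
...   | inj₂ R₀ = s≤s (count-tail≤1 P amoR amoQ (λ u → swap ∘ cover u) R₀)
count≤2 {suc n} P Q R amoQ amoR cover | false =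
  count≤2 (P ∘ suc) (Q ∘ suc) (R ∘ suc) (λ p q → suc-injective (amoQ p q))
          (λ p q → suc-injective (amoR p q)) (cover ∘ suc)

∑-mono-≤ : ∀ {n} {f g : Fin n → ℕ} → (∀ i → f i ≤ g i) → ∑[ i < n ] f i ≤ ∑[ i < n ] g i
∑-mono-≤ {zero} f≤g = z≤n
∑-mono-≤ {suc n} f≤g = +-mono-≤ (f≤g zero) (∑-mono-≤ (f≤g ∘ suc))

∑-mono-< : ∀ {n} {f g : Fin n → ℕ} → (∀ i → f i ≤ g i) → ∀ a → f a < g a →
           ∑[ i < n ] f i < ∑[ i < n ] g i
∑-mono-< f≤g zero fa<ga = +-mono-<-≤ fa<ga (∑-mono-≤ (f≤g ∘ suc))
∑-mono-< f≤g (suc a) fa<ga = +-mono-≤-< (f≤g zero) (∑-mono-< (f≤g ∘ suc) a fa<ga)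

split-by-order : ∀ {n} (i j : Fin n) {b} → (i ≡ j → b ≡ false) →
                 b2n (does (i <? j) ∧ b) + b2n (does (j <? i) ∧ b) ≡ b2n b
split-by-order i j {b} loop with <-cmp i j
... | tri< i<j _ _ rewrite dec-true (i <? j) i<j | dec-false (j <? i) (<-asym i<j) =
  +-identityʳ (b2n b)
... | tri≈ _ refl _ rewrite loop refl | ∧-zeroʳ (does (i <? i)) = refl
... | tri> _ _ j<i rewrite dec-false (i <? j) (<-asym j<i) | dec-true (j <? i) j<i = refl

module _ {n} {adj : Fin n → Fin n → Bool} (J : Subgraph adj) where
  open Subgraph J

  handshake : (∀ i → E i i ≡ false) → 2 * eJ J ≡ ∑[ i < n ] count (E i)
  handshake loopless = begin
    2 * eJ J                                                       ≡⟨ cong (eJ J +_) (+-identityʳ (eJ J)) ⟩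
    eJ J + eJ J                                                    ≡⟨ cong₂ _+_ eJ-as-∑ eJ-as-∑ ⟩
    ∑[ i < n ] ∑[ j < n ] fwd i j + ∑[ i < n ] ∑[ j < n ] fwd i j  ≡⟨ cong (∑∑fwd +_) (∑-comm fwd) ⟩
    ∑[ i < n ] ∑[ j < n ] fwd i j + ∑[ i < n ] ∑[ j < n ] fwd j i
      ≡⟨ sym (∑-distrib-+ (λ i → ∑[ j < n ] fwd i j) (λ i → ∑[ j < n ] fwd j i)) ⟩
    ∑[ i < n ] (∑[ j < n ] fwd i j + ∑[ j < n ] fwd j i)           ≡⟨ sum-cong-≗ row ⟩
    ∑[ i < n ] count (E i)                                         ∎
    where
    open ≡-Reasoning
    fwd : Fin n → Fin n → ℕ
    fwd i j = b2n (does (i <? j) ∧ E i j)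
    ∑∑fwd : ℕ
    ∑∑fwd = ∑[ i < n ] ∑[ j < n ] fwd i j
    eJ-as-∑ : eJ J ≡ ∑[ i < n ] ∑[ j < n ] fwd i j
    eJ-as-∑ = trans (sum-map-allFin (λ i → count (λ j → does (i <? j) ∧ E i j)))
                    (sum-cong-≗ (λ i → count≡∑ (λ j → does (i <? j) ∧ E i j)))
    row : ∀ i → ∑[ j < n ] fwd i j + ∑[ j < n ] fwd j i ≡ count (E i)
    row i = begin
      ∑[ j < n ] fwd i j + ∑[ j < n ] fwd j i             ≡⟨ sym (∑-distrib-+ (fwd i) (λ j → fwd j i)) ⟩
      ∑[ j < n ] (fwd i j + fwd j i)
        ≡⟨ sum-cong-≗ (λ j → cong (λ b → fwd i j + b2n (does (j <? i) ∧ b)) (Esym j i)) ⟩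
      ∑[ j < n ] (fwd i j + b2n (does (j <? i) ∧ E i j))
        ≡⟨ sum-cong-≗ (λ j → split-by-order i j (λ { refl → loopless i })) ⟩
      ∑[ j < n ] b2n (E i j)                              ≡⟨ sym (count≡∑ (E i)) ⟩
      count (E i)                                         ∎

-- The cyclic successor

next : ∀ {ℓ} → Fin ℓ → Fin ℓ
next {suc m} u = fromℕ< (m%n<n (suc (toℕ u)) (suc m))

toℕ-next : ∀ {ℓ} (u : Fin ℓ) → toℕ (next u) ≡ cnext u
toℕ-next {suc m} u = toℕ-fromℕ< (m%n<n (suc (toℕ u)) (suc m))

[m+n%d]%d≡[m+n]%d : ∀ m n d .{{_ : NonZero d}} → (m + n % d) % d ≡ (m + n) % d
[m+n%d]%d≡[m+n]%d m n d = begin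
  (m + n % d) % d          ≡⟨ %-distribˡ-+ m (n % d) d ⟩
  (m % d + n % d % d) % d  ≡⟨ cong (λ k → (m % d + k) % d) (m%n%n≡m%n n d) ⟩
  (m % d + n % d) % d      ≡⟨ sym (%-distribˡ-+ m n d) ⟩
  (m + n) % d              ∎
  where open ≡-Reasoning

toℕ-iterate-next : ∀ {m} (u : Fin (suc m)) k → toℕ (iterate next u k) ≡ (k + toℕ u) % suc m
toℕ-iterate-next {m} u zero = sym (m<n⇒m%n≡m (toℕ<n u))
toℕ-iterate-next {m} u (suc k) = begin
  toℕ (iterate next (next u) k)      ≡⟨ toℕ-iterate-next (next u) k ⟩
  (k + toℕ (next u)) % suc m         ≡⟨ cong (λ x → (k + x) % suc m) (toℕ-next u) ⟩
  (k + suc (toℕ u) % suc m) % suc m  ≡⟨ [m+n%d]%d≡[m+n]%d k (suc (toℕ u)) (suc m) ⟩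
  (k + suc (toℕ u)) % suc m          ≡⟨ cong (_% suc m) (+-suc k (toℕ u)) ⟩
  (suc k + toℕ u) % suc m            ∎
  where open ≡-Reasoning

iterate-next-period : ∀ {ℓ} (u : Fin ℓ) → iterate next u ℓ ≡ u
iterate-next-period {suc m} u = toℕ-injective (begin
  toℕ (iterate next u (suc m))  ≡⟨ toℕ-iterate-next u (suc m) ⟩
  (suc m + toℕ u) % suc m       ≡⟨ cong (_% suc m) (+-comm (suc m) (toℕ u)) ⟩
  (toℕ u + suc m) % suc m       ≡⟨ [m+n]%n≡m%n (toℕ u) (suc m) ⟩
  toℕ u % suc m                 ≡⟨ m<n⇒m%n≡m (toℕ<n u) ⟩
  toℕ u                         ∎)
  where open ≡-Reasoning

iterate-next-surjective : ∀ {ℓ} (u v : Fin ℓ) → ∃ λ k → iterate next u k ≡ v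
iterate-next-surjective {suc m} u v = k , toℕ-injective (begin
  toℕ (iterate next u k)                     ≡⟨ toℕ-iterate-next u k ⟩
  (toℕ v + (suc m ∸ toℕ u) + toℕ u) % suc m  ≡⟨ cong (_% suc m) (+-assoc (toℕ v) _ (toℕ u)) ⟩
  (toℕ v + (suc m ∸ toℕ u + toℕ u)) % suc m
    ≡⟨ cong (λ x → (toℕ v + x) % suc m) (m∸n+n≡m (<⇒≤ (toℕ<n u))) ⟩
  (toℕ v + suc m) % suc m                    ≡⟨ [m+n]%n≡m%n (toℕ v) (suc m) ⟩
  toℕ v % suc m                              ≡⟨ m<n⇒m%n≡m (toℕ<n v) ⟩
  toℕ v                                      ∎)
  where
  open ≡-Reasoning
  k = toℕ v + (suc m ∸ toℕ u)

next-injective : ∀ {ℓ} {u v : Fin ℓ} → next u ≡ next v → u ≡ v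
next-injective {suc m} {u} {v} e = begin
  u                        ≡⟨ sym (iterate-next-period u) ⟩
  iterate next (next u) m  ≡⟨ cong (λ w → iterate next w m) e ⟩
  iterate next (next v) m  ≡⟨ iterate-next-period v ⟩
  v                        ∎
  where open ≡-Reasoning

next≢id : ∀ {ℓ} → 2 ≤ ℓ → (u : Fin ℓ) → next u ≢ u
next≢id {suc m} 2≤ℓ u e with m≤n⇒m<n∨m≡n (toℕ<n u)
... | inj₁ 1+u<ℓ = 1+n≢n (begin
  suc (toℕ u)          ≡⟨ sym (m<n⇒m%n≡m 1+u<ℓ) ⟩
  suc (toℕ u) % suc m  ≡⟨ sym (toℕ-next u) ⟩
  toℕ (next u)         ≡⟨ cong toℕ e ⟩
  toℕ u                ∎)
  where open ≡-Reasoning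
... | inj₂ 1+u≡ℓ = <⇒≢ 2≤ℓ (trans (cong suc (sym u≡0)) 1+u≡ℓ)
  where
  open ≡-Reasoning
  u≡0 : toℕ u ≡ 0
  u≡0 = begin
    toℕ u                ≡⟨ cong toℕ (sym e) ⟩
    toℕ (next u)         ≡⟨ toℕ-next u ⟩
    suc (toℕ u) % suc m  ≡⟨ cong (_% suc m) 1+u≡ℓ ⟩
    suc m % suc m        ≡⟨ n%n≡0 (suc m) ⟩
    0                    ∎

-- Subgraphs of a cycle

∨-true : ∀ {x y} → x ∨ y ≡ true → x ≡ true ⊎ y ≡ true
∨-true {true} _ = inj₁ refl
∨-true {false} y≡true = inj₂ y≡true

≡ᵇ-cnext⇒≡next : ∀ {ℓ} {u v : Fin ℓ} → (toℕ v ≡ᵇ cnext u) ≡ true → v ≡ next u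
≡ᵇ-cnext⇒≡next {u = u} {v} e =
  toℕ-injective (trans (≡ᵇ⇒≡ (toℕ v) (cnext u) (Equivalence.from T-≡ e)) (sym (toℕ-next u)))

module _ (C : OrientedCycle) where
  open OrientedCycle C

  arc⇒adjacent : ∀ u v → arc C u v ≡ true → v ≡ next u ⊎ u ≡ next v
  arc⇒adjacent u v a with ∨-true {(toℕ v ≡ᵇ cnext u) ∧ dir u} a
  ... | inj₁ forward = inj₁ (≡ᵇ-cnext⇒≡next (∧-conicalˡ _ _ forward))
  ... | inj₂ backward = inj₂ (≡ᵇ-cnext⇒≡next (∧-conicalˡ _ _ backward))

  underlying⇒adjacent : ∀ u v → underlying C u v ≡ true → v ≡ next u ⊎ u ≡ next v
  underlying⇒adjacent u v e with ∨-true {arc C u v} e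
  ... | inj₁ a = arc⇒adjacent u v a
  ... | inj₂ a = swap (arc⇒adjacent v u a)

  underlying-irrefl : 2 ≤ ℓ → ∀ u → underlying C u u ≢ true
  underlying-irrefl 2≤ℓ u e = next≢id 2≤ℓ u (sym (reduce (underlying⇒adjacent u u e)))

  count-next-closed : (S : Fin ℓ → Bool) → (∀ w → S w ≡ true → S (next w) ≡ true) →
                      count S ≡ 0 ⊎ ℓ ≤ count S
  count-next-closed S closed with any? (λ x → S x Bool.≟ true)
  ... | no empty = inj₁ (count-none S (λ x Sx → empty (x , Sx)))
  ... | yes (x , Sx) = inj₂ (injective⇒≤count S (λ v → v) (λ e → e) everywhere)
    where
    orbit : ∀ {w} k → S w ≡ true → S (iterate next w k) ≡ true
    orbit zero Sw = Sw
    orbit (suc k) Sw = orbit k (closed _ Sw)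
    everywhere : ∀ v → S v ≡ true
    everywhere v with iterate-next-surjective x v
    ... | k , refl = orbit k Sx

  module _ (J : Subgraph (underlying C)) where
    open Subgraph J

    degree≤2 : ∀ w → count (E w) ≤ 2 * b2n (S w)
    degree≤2 w with S w in Sw
    ... | false = ≤-reflexive (count-none (E w) (λ u Ewu → not-¬ Sw (Eend w u Ewu)))
    ... | true = count≤2 (E w) (_≡ next w) (λ u → w ≡ next u) (λ p q → trans p (sym q))
                   (λ p q → next-injective (trans (sym p) q))
                   (λ u Ewu → underlying⇒adjacent w u (E⊆ w u Ewu))

    degree≤1 : ∀ w → S (next w) ≡ false → count (E w) ≤ 1
    degree≤1 w gap = count≤1 (E w) (λ u → w ≡ next u) (λ p q → next-injective (trans (sym p) q)) back
      where
      back : ∀ u → E w u ≡ true → w ≡ next u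
      back u Ewu with underlying⇒adjacent w u (E⊆ w u Ewu)
      ... | inj₁ refl = ⊥-elim (not-¬ gap (Eend (next w) w (trans (Esym (next w) w) Ewu)))
      ... | inj₂ w≡next = w≡next

    cycle-loopless : 2 ≤ ℓ → ∀ i → E i i ≡ false
    cycle-loopless 2≤ℓ i = ¬-not (underlying-irrefl 2≤ℓ i ∘ E⊆ i i)

    ∑[2S]≡2vJ : ∑[ w < ℓ ] (2 * b2n (S w)) ≡ 2 * vJ J
    ∑[2S]≡2vJ = trans (sym (*-distribˡ-sum 2 (b2n ∘ S))) (cong (2 *_) (sym (count≡∑ S)))

    eJ≤vJ : 2 ≤ ℓ → eJ J ≤ vJ J
    eJ≤vJ 2≤ℓ = *-cancelˡ-≤ 2 (begin
      2 * eJ J                    ≡⟨ handshake J (cycle-loopless 2≤ℓ) ⟩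
      ∑[ w < ℓ ] count (E w)      ≤⟨ ∑-mono-≤ degree≤2 ⟩
      ∑[ w < ℓ ] (2 * b2n (S w))  ≡⟨ ∑[2S]≡2vJ ⟩
      2 * vJ J                    ∎)
      where open ≤-Reasoning

    -- Three vertices of a cycle of length ≥ 4 are not closed under next, so one of them
    -- has its successor outside S and hence degree ≤ 1 in J.
    eJ<vJ : 4 ≤ ℓ → vJ J ≡ 3 → eJ J < vJ J
    eJ<vJ 4≤ℓ v≡3 with any? (λ w → (S w Bool.≟ true) ×-dec (S (next w) Bool.≟ false))
    ... | yes (w , Sw , gap) = *-cancelˡ-< 2 (eJ J) (vJ J) (begin-strict
      2 * eJ J                    ≡⟨ handshake J (cycle-loopless (≤-trans (s≤s (s≤s z≤n)) 4≤ℓ)) ⟩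
      ∑[ u < ℓ ] count (E u)      <⟨ ∑-mono-< degree≤2 w exit ⟩
      ∑[ u < ℓ ] (2 * b2n (S u))  ≡⟨ ∑[2S]≡2vJ ⟩
      2 * vJ J                    ∎)
      where
      open ≤-Reasoning
      exit : count (E w) < 2 * b2n (S w)
      exit = subst (λ b → count (E w) < 2 * b2n b) (sym Sw) (s≤s (degree≤1 w gap))
    ... | no no-exit with count-next-closed S (λ w Sw → ¬-not (λ gap → no-exit (w , Sw , gap)))
    ...   | inj₁ v≡0 = ⊥-elim (1+n≢0 (trans (sym v≡3) v≡0))
    ...   | inj₂ ℓ≤v = ⊥-elim (<⇒≱ (≤-trans 4≤ℓ ℓ≤v) (≤-reflexive v≡3))

m₂-arith : ∀ {e v} → 3 ≤ v → e ≤ v → (v ≡ 3 → e < v) → 2 * (e ∸ 1) ≤ 3 * (v ∸ 2)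
m₂-arith {v = 1} (s≤s ()) _ _
m₂-arith {v = 2} (s≤s (s≤s ())) _ _
m₂-arith {e} {3} _ _ e<3 = ≤-trans (*-monoʳ-≤ 2 (∸-monoˡ-≤ 1 (≤-pred (e<3 refl)))) (s≤s (s≤s z≤n))
m₂-arith {e} {suc (suc (suc (suc w)))} _ e≤v _ =
  ≤-trans (*-monoʳ-≤ 2 (∸-monoˡ-≤ 1 e≤v)) (subst (2 * (3 + w) ≤_) (identity w) (m≤m+n _ w))
  where
  identity : ∀ w → 2 * (3 + w) + w ≡ 3 * (2 + w)
  identity = solve-∀

m₂-cycle≤3/2 : (C : OrientedCycle) → 4 ≤ OrientedCycle.ℓ C → (J : Subgraph (underlying C)) →
               3 ≤ vJ J → 2 * (eJ J ∸ 1) ≤ 3 * (vJ J ∸ 2)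
m₂-cycle≤3/2 C 4≤ℓ J 3≤v =
  m₂-arith 3≤v (eJ≤vJ C J (≤-trans (s≤s (s≤s z≤n)) 4≤ℓ)) (eJ<vJ C J 4≤ℓ)

cross-<-≤-trans : ∀ {a b e v x y} .{{_ : NonZero b}} → e * x < y * v → b * y ≤ a * x → b * e < a * v
cross-<-≤-trans {a} {b} {e} {v} {x} {y} ex<yv by≤ax =
  ≰⇒> λ av≤be → <⇒≱ (*-monoʳ-< b ex<yv) (begin
    b * (y * v)  ≡⟨ sym (*-assoc b y v) ⟩
    b * y * v    ≤⟨ *-monoˡ-≤ v by≤ax ⟩
    a * x * v    ≡⟨ rearrange a x v ⟩
    x * (a * v)  ≤⟨ *-monoʳ-≤ x av≤be ⟩
    x * (b * e)  ≡⟨ rearrange′ b x e ⟩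
    b * (e * x)  ∎)
  where
  open ≤-Reasoning
  rearrange : ∀ a x v → a * x * v ≡ x * (a * v)
  rearrange = solve-∀
  rearrange′ : ∀ b x e → x * (b * e) ≡ b * (e * x)
  rearrange′ = solve-∀

-- Degenerate graphs and colour orientations

free-colour : ∀ {n k} (c : Fin n → Fin k) (N : Fin n → Bool) → count N < k →
              Σ (Fin k) λ a → ∀ u → N u ≡ true → c u ≢ a
free-colour {n} {k} c N small = choose (all? used?)
  where
  Used : Fin k → Set
  Used a = ∃ λ u → N u ≡ true × c u ≡ a
  used? : ∀ a → Dec (Used a)
  used? a = any? (λ u → (N u Bool.≟ true) ×-dec (c u ≟ a))
  choose : Dec (∀ a → Used a) → Σ (Fin k) λ a → ∀ u → N u ≡ true → c u ≢ a
  choose (yes used) = ⊥-elim (<⇒≱ small (injective⇒≤count N witness witness-injective (proj₁ ∘ proj₂ ∘ used)))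
    where
    witness : Fin k → Fin n
    witness a = proj₁ (used a)
    witness-injective : Injective _≡_ _≡_ witness
    witness-injective {a} {b} e =
      trans (sym (proj₂ (proj₂ (used a)))) (trans (cong c e) (proj₂ (proj₂ (used b))))
  choose (no some-unused) with ¬∀⟶∃¬ k Used used? some-unused
  ... | a , unused = a , λ u Nu cu≡a → unused (u , Nu , cu≡a)

does⇒ : ∀ {A : Set} (a? : Dec A) → does a? ≡ true → A
does⇒ (yes a) _ = a

index≤last : ∀ {m} (f : Fin (suc m) → ℕ) → (∀ i → f (inject₁ i) < f (suc i)) → m ≤ f (fromℕ m)
index≤last {zero} f _ = z≤n
index≤last {suc m} f step =
  ≤-trans (s≤s (index≤last (f ∘ inject₁) (step ∘ inject₁))) (step (fromℕ m))

module _ (G : Graph) where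
  open Graph G renaming (sym to adj-sym)

  ProperOn : ∀ {k} → (Fin n → Bool) → (Fin n → Fin k) → Set
  ProperOn R c = ∀ {i j} → R i ≡ true → R j ≡ true → adj i j ≡ true → c i ≢ c j

  Colouring : ℕ → Set
  Colouring k = Σ (Fin n → Fin k) (ProperOn (λ _ → true))

  degreeIn : (Fin n → Bool) → Fin n → ℕ
  degreeIn R v = count (λ u → R u ∧ adj v u)

  Degenerate : ℕ → Set
  Degenerate d =
    ∀ (R : Fin n → Bool) {x} → R x ≡ true → Σ (Fin n) λ v → R v ≡ true × degreeIn R v ≤ d

  extend-colouring : ∀ {k} (R : Fin n → Bool) (v : Fin n) (c : Fin n → Fin k) →
                     ProperOn (R without v) c → (a : Fin k) →
                     (∀ u → R u ∧ adj v u ≡ true → c u ≢ a) → Σ (Fin n → Fin k) (ProperOn R)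
  extend-colouring {k} R v c proper a free = c′ , proper′
    where
    c′ : Fin n → Fin k
    c′ u with u ≟ v
    ... | yes _ = a
    ... | no _ = c u
    proper′ : ProperOn R c′
    proper′ {i} {j} Ri Rj adj-ij with i ≟ v | j ≟ v
    ... | yes refl | yes refl = λ _ → not-¬ (irrefl i) adj-ij
    ... | yes refl | no _ = free j (subst (λ b → b ∧ adj i j ≡ true) (sym Rj) adj-ij) ∘ sym
    ... | no _ | yes refl = free i (subst₂ (λ b b′ → b ∧ b′ ≡ true) (sym Ri) (adj-sym i j) adj-ij)
    ... | no i≢v | no j≢v = proper (without-true R Ri i≢v) (without-true R Rj j≢v) adj-ij

  degenerate⇒colourableOn : ∀ {d} → Degenerate d → ∀ s (R : Fin n → Bool) → count R ≤ s →
                            Σ (Fin n → Fin (suc d)) (ProperOn R)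
  degenerate⇒colourableOn deg s R size with any? (λ x → R x Bool.≟ true)
  ... | no empty = (λ _ → zero) , λ Ri _ _ _ → empty (_ , Ri)
  degenerate⇒colourableOn deg zero R size | yes (x , Rx) = ⊥-elim (<⇒≱ (count-pos R Rx) size)
  degenerate⇒colourableOn deg (suc s) R size | yes (x , Rx) with deg R Rx
  ... | v , Rv , low-degree
    with degenerate⇒colourableOn deg s (R without v)
           (≤-pred (subst (_≤ suc s) (count-remove R Rv) size))
  ... | c , proper with free-colour c (λ u → R u ∧ adj v u) (s≤s low-degree)
  ... | a , free = extend-colouring R v c proper a free

  degenerate⇒colourable : ∀ {d} → Degenerate d → Colouring (suc d)
  degenerate⇒colourable deg = degenerate⇒colourableOn deg _ (λ _ → true) ≤-refl

  m<3/2 : Set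
  m<3/2 = (J : Subgraph adj) → 1 ≤ vJ J → 2 * eJ J < 3 * vJ J

  induced : (Fin n → Bool) → Subgraph adj
  induced R = record
    { S    = R
    ; E    = λ i j → (R i ∧ R j) ∧ adj i j
    ; E⊆   = λ i j → ∧-conicalʳ (R i ∧ R j) _
    ; Esym = λ i j → cong₂ _∧_ (∧-comm (R i) (R j)) (adj-sym i j)
    ; Eend = λ i j → ∧-conicalˡ (R i) _ ∘ ∧-conicalˡ (R i ∧ R j) _
    }

  m<3/2⇒2-degenerate : m<3/2 → Degenerate 2
  m<3/2⇒2-degenerate sparse R {x} Rx
    with any? (λ v → (R v Bool.≟ true) ×-dec (degreeIn R v ≤? 2))
  ... | yes low = low
  ... | no none = ⊥-elim (<⇒≱ (sparse (induced R) (count-pos R Rx)) (begin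
    3 * count R                                  ≡⟨ cong (3 *_) (count≡∑ R) ⟩
    3 * ∑[ i < n ] b2n (R i)                     ≡⟨ *-distribˡ-sum 3 (b2n ∘ R) ⟩
    ∑[ i < n ] (3 * b2n (R i))                   ≤⟨ ∑-mono-≤ rich ⟩
    ∑[ i < n ] count (Subgraph.E (induced R) i)  ≡⟨ sym (handshake (induced R) loopless) ⟩
    2 * eJ (induced R)                           ∎))
    where
    open ≤-Reasoning
    rich : ∀ i → 3 * b2n (R i) ≤ count (Subgraph.E (induced R) i)
    rich i with R i in Ri
    ... | false = z≤n
    ... | true = ≰⇒> (λ d≤2 → none (i , Ri , d≤2))
    loopless : ∀ i → Subgraph.E (induced R) i i ≡ false
    loopless i rewrite irrefl i = ∧-zeroʳ (R i ∧ R i)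

  ascending : ∀ {k} → (Fin n → Fin k) → Fin n → Fin n → Bool
  ascending c i j = adj i j ∧ does (c i <? c j)

  ascending⇒< : ∀ {k} (c : Fin n → Fin k) {i j} → ascending c i j ≡ true → toℕ (c i) < toℕ (c j)
  ascending⇒< c {i} {j} asc = does⇒ (c i <? c j) (∧-conicalʳ (adj i j) _ asc)

  colour-orientation : ∀ {k} → Colouring k → Orientation G
  colour-orientation (c , proper) = record
    { o     = ascending c
    ; o⊆    = λ i j → ∧-conicalˡ (adj i j) _
    ; total = total
    ; anti  = λ i j asc → anti (ascending⇒< c asc)
    }
    where
    total : ∀ i j → adj i j ≡ true → ascending c i j ≡ true ⊎ ascending c j i ≡ true
    total i j adj-ij with <-cmp (c i) (c j)
    ... | tri< ci<cj _ _ rewrite adj-ij | dec-true (c i <? c j) ci<cj = inj₁ refl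
    ... | tri≈ _ ci≡cj _ = ⊥-elim (proper refl refl adj-ij ci≡cj)
    ... | tri> _ _ cj<ci rewrite adj-sym j i | adj-ij | dec-true (c j <? c i) cj<ci = inj₂ refl
    anti : ∀ {i j} → toℕ (c i) < toℕ (c j) → ascending c j i ≡ false
    anti {i} {j} ci<cj rewrite dec-false (c j <? c i) (<-asym ci<cj) = ∧-zeroʳ (adj j i)

  dirPath-length<colours : (C : OrientedCycle) {k : ℕ} (col : Colouring k) →
                           ContainsCopy (colour-orientation col) C → ∀ {m} → DirPath C m → m < k
  dirPath-length<colours C (c , _) (φ , _ , preserves) P =
    ≤-<-trans (index≤last height climb) (toℕ<n (c (φ (DirPath.p P (fromℕ _)))))
    where
    height : Fin _ → ℕ
    height i = toℕ (c (φ (DirPath.p P i)))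
    climb : ∀ i → height (inject₁ i) < height (suc i)
    climb i = ascending⇒< c (preserves _ _ (DirPath.arcs P i))

lemma15 : (C : OrientedCycle) → HasLongBlock C →
          (G : Graph) → mLessm₂ (Graph.adj G) (underlying C) →
          Σ (Orientation G) λ O → ¬ ContainsCopy O C
lemma15 C (k , P , _ , 3≤k) G (J , 3≤vJ , beats) =
  colour-orientation G colouring , λ copy → <⇒≱ (dirPath-length<colours G C colouring copy P) 3≤k
  where
  4≤ℓ : 4 ≤ OrientedCycle.ℓ C
  4≤ℓ = ≤-trans (s≤s 3≤k) (injective⇒≤ (DirPath.inj P))
  density : m<3/2 G
  density J′ 1≤vJ′ =
    cross-<-≤-trans {3} {2} {eJ J′} {vJ J′} {vJ J ∸ 2} {eJ J ∸ 1}
      (beats J′ 1≤vJ′) (m₂-cycle≤3/2 C 4≤ℓ J 3≤vJ)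
  colouring : Colouring G 3
  colouring = degenerate⇒colourable G (m<3/2⇒2-degenerate G density)
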